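{- Let $G$ be a graph with $n$ vertices and $m$ edges, and suppose $G_1$, $G_2$, $S$ are induced subgraphs of $G$ with $G=G_1\cup G_2$ and $G_1\cap G_2=S$. Suppose $G_i$ has $n_i$ vertices and $m_i$ edges ($i=1,2$), and $S$ has $n_S$ vertices and $m_S$ edges. Let $x,y,z$ be real numbers. If $c(G_i)\leq xn_i+ym_i+z$ for $i=1,2$ and $c(S)\geq xn_S+ym_S+z$, then $c(G)\leq xn+ym+z$.
   Context: All graphs are finite, simple and undirected. A clique is a (possibly empty) set of pairwise adjacent vertices; $c(H)$ denotes the number of cliques of $H$ (including $\emptyset$ and single vertices). -}

module Defs where

open import Data.Nat using (ℕ; zero; suc; _<ᵇ_)
open import Data.Bool using (Bool; true; false; _∧_; _∨_; not; if_then_else_)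
open import Data.Fin using (Fin; toℕ; _≟_)
open import Data.Fin.Subset using (Subset; inside; outside; ⊤; ∣_∣)
open import Data.Vec using (Vec; []; _∷_; lookup)
open import Data.List using (List; []; _∷_; [_]; map; _++_; allFin; concatMap)
open import Data.Nat.ListAction using (sum)
open import Data.Bool.ListAction using (and)
open import Relation.Nullary using (does)
open import Relation.Binary.PropositionalEquality using (_≡_)
open import Relation.Binary.Structures using (IsTotalOrder)
open import Algebra.Bundles using (CommutativeRing)
open import Level using (Level; suc; _⊔_)

record Graph (n : ℕ) : Set where
  field
    adj    : Fin n → Fin n → Bool
    sym    : ∀ i j → adj i j ≡ adj j i
    irrefl : ∀ i → adj i i ≡ false
open Graph public

allSubsets : (n : ℕ) → List (Subset n)
allSubsets zero = [ [] ]
allSubsets (ℕ.suc n) = map (outside ∷_) (allSubsets n) ++ map (inside ∷_) (allSubsets n)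

mem : {n : ℕ} → Fin n → Subset n → Bool
mem i U with lookup U i
... | inside = true
... | outside = false

countᵇ : {A : Set} → (A → Bool) → List A → ℕ
countᵇ p xs = sum (map (λ a → if p a then 1 else 0) xs)

subsetᵇ : {n : ℕ} → Subset n → Subset n → Bool
subsetᵇ C U = and (map (λ i → not (mem i C) ∨ mem i U) (allFin _))

isCliqueᵇ : {n : ℕ} → Graph n → Subset n → Bool
isCliqueᵇ G C = and (concatMap (λ i → map (λ j →
  not (mem i C ∧ mem j C ∧ not (does (i ≟ j))) ∨ adj G i j) (allFin _)) (allFin _))

-- c(G[U]) : number of cliques (including ∅) of the induced subgraph G[U]
cliquesIn : {n : ℕ} → Graph n → Subset n → ℕ
cliquesIn {n} G U = countᵇ (λ C → subsetᵇ C U ∧ isCliqueᵇ G C) (allSubsets n)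

verticesIn : {n : ℕ} → Subset n → ℕ
verticesIn U = ∣ U ∣

edgesIn : {n : ℕ} → Graph n → Subset n → ℕ
edgesIn {n} G U = sum (map (λ i → countᵇ (λ j →
  (toℕ i <ᵇ toℕ j) ∧ mem i U ∧ mem j U ∧ adj G i j) (allFin n)) (allFin n))

c : {n : ℕ} → Graph n → ℕ
c G = cliquesIn G ⊤

edges : {n : ℕ} → Graph n → ℕ
edges G = edgesIn G ⊤

-- A totally ordered commutative ring (ℝ is an instance); stands in for
-- the real numbers, which agda-stdlib lacks.
record OrderedCommRing (a ℓ₁ ℓ₂ : Level) : Set (Level.suc (a ⊔ ℓ₁ ⊔ ℓ₂)) where
  field
    commRing : CommutativeRing a ℓ₁
  open CommutativeRing commRing public
  field
    _≤_         : Carrier → Carrier → Set ℓ₂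
    isTotalOrder : IsTotalOrder _≈_ _≤_
    +-mono-≤    : ∀ {x y} z → x ≤ y → (x + z) ≤ (y + z)
    *-nonneg    : ∀ {x y} → 0# ≤ x → 0# ≤ y → 0# ≤ (x * y)

  ι : ℕ → Carrier
  ι zero = 0#
  ι (ℕ.suc k) = 1# + ι k

{-# OPTIONS --safe #-}
module Submission where

-- Every clique of G lies inside V₁ or inside V₂, since a clique meeting both V₁ ∖ V₂ and
-- V₂ ∖ V₁ would contain an edge between them.  Hence c(G₁) + c(G₂) = c(G) + c(S), and the
-- vertex and edge counts obey the same inclusion–exclusion law.  The bound x·n + y·m + z is
-- affine in these counts, so subtracting the lower bound for S from the sum of the upper
-- bounds for G₁ and G₂ gives the bound for G.

open import Defs hiding (sym)
open import Level using (Level)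
open import Data.Nat using (ℕ)
open import Data.Fin.Subset using (Subset; _∪_; _∩_; _∈_; ⊤)
open import Data.Bool using (true)
open import Data.Product using (_×_)
open import Data.Sum using (_⊎_)
open import Relation.Binary.PropositionalEquality using (_≡_)
import Relation.Binary.PropositionalEquality as ≡

-- ℕ's _+_ and ≡'s sym are opened only inside this module, so that they do not clash with
-- the ring operations opened in the statement of lemma1.
module Counting where

  open import Data.Nat using (suc; _+_; _<ᵇ_)
  open import Data.Nat.Properties using (+-suc; +-commutativeSemigroup)
  open import Data.Bool using (Bool; false; T; _∧_; _∨_; not; if_then_else_)
  open import Data.Bool.Properties
    using (T-≡; T-∧; T-∨; T-not-≡; ∧-assoc; ∧-idem; ∧-identityʳ; ∧-zeroʳ; ∨-distribˡ-∧;
           ∧-commutativeMonoid; ∧-idempotentCommutativeMonoid)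
  open import Data.Fin using (Fin; toℕ; _≟_)
  open import Data.Fin.Subset using (inside; outside; _∉_; _⊆_; ∣_∣)
  open import Data.Fin.Subset.Properties using (∈⊤; x∈p∪q⁻; _⊆?_; _∈?_; ∣⊤∣≡n)
  open import Data.Vec using ([]; _∷_; lookup)
  open import Data.Vec.Properties using (lookup-zipWith; lookup-replicate; []=⇒lookup; lookup⇒[]=)
  open import Data.List using ([]; _∷_; map; allFin)
  open import Data.List.Properties using (map-cong)
  open import Data.List.Relation.Unary.All as All using (All; []; _∷_)
  open import Data.List.Relation.Unary.All.Properties using (all⁻; map⁻; concat⁻)
  open import Data.List.Membership.Propositional.Properties using (∈-allFin)
  open import Data.Nat.ListAction using (sum)
  open import Data.Bool.ListAction using (and; all)
  open import Data.Product using (_,_; proj₁; proj₂)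
  open import Data.Sum using (inj₁; inj₂; [_,_]′)
  import Data.Sum as Sum
  open import Function using (_$_; _∘_; id; const; flip)
  open import Function.Bundles using (_⇔_; mk⇔; Equivalence)
  open import Relation.Nullary using (yes; no; does; contradiction)
  open import Relation.Nullary.Decidable using (dec-false; decidable-stable)
  open import Relation.Binary.PropositionalEquality
    using (_≢_; refl; sym; trans; cong; cong₂; subst; module ≡-Reasoning)
  open import Algebra.Bundles using (CommutativeMonoid)
  import Algebra.Properties.CommutativeSemigroup as CommutativeSemigroupProperties
  import Algebra.Solver.IdempotentCommutativeMonoid as ∧-Solver

  open Equivalence using (to; from)
  open CommutativeSemigroupProperties +-commutativeSemigroup
    using () renaming (interchange to +-interchange)
  open CommutativeSemigroupProperties (CommutativeMonoid.commutativeSemigroup ∧-commutativeMonoid)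
    using () renaming (interchange to ∧-interchange)

  private
    variable
      A : Set
      n : ℕ

  indicator-inclusion-exclusion : ∀ a b →
    (if a then 1 else 0) + (if b then 1 else 0) ≡ (if a ∨ b then 1 else 0) + (if a ∧ b then 1 else 0)
  indicator-inclusion-exclusion true  true  = refl
  indicator-inclusion-exclusion true  false = refl
  indicator-inclusion-exclusion false true  = refl
  indicator-inclusion-exclusion false false = refl

  sum-map-+ : ∀ (f g : A → ℕ) xs → sum (map (λ x → f x + g x) xs) ≡ sum (map f xs) + sum (map g xs)
  sum-map-+ f g []       = refl
  sum-map-+ f g (x ∷ xs) = trans (cong (f x + g x +_) (sum-map-+ f g xs))
                                 (+-interchange (f x) (g x) (sum (map f xs)) (sum (map g xs)))

  sum-map-inclusion-exclusion : ∀ {f g h k : A → ℕ} → (∀ x → f x + g x ≡ h x + k x) → ∀ xs →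
    sum (map f xs) + sum (map g xs) ≡ sum (map h xs) + sum (map k xs)
  sum-map-inclusion-exclusion {f = f} {g} {h} {k} eq xs = begin
    sum (map f xs) + sum (map g xs)           ≡⟨ sym (sum-map-+ f g xs) ⟩
    sum (map (λ x → f x + g x) xs)            ≡⟨ cong sum (map-cong eq xs) ⟩
    sum (map (λ x → h x + k x) xs)            ≡⟨ sum-map-+ h k xs ⟩
    sum (map h xs) + sum (map k xs)           ∎
    where open ≡-Reasoning

  countᵇ-inclusion-exclusion : ∀ {p q r s : A → Bool} →
    (∀ x → p x ∨ q x ≡ r x) → (∀ x → p x ∧ q x ≡ s x) → ∀ xs →
    countᵇ p xs + countᵇ q xs ≡ countᵇ r xs + countᵇ s xs
  countᵇ-inclusion-exclusion {p = p} {q} join meet = sum-map-inclusion-exclusion λ x →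
    trans (indicator-inclusion-exclusion (p x) (q x))
          (cong₂ (λ a b → (if a then 1 else 0) + (if b then 1 else 0)) (join x) (meet x))

  ∣p∣+∣q∣≡∣p∪q∣+∣p∩q∣ : ∀ (p q : Subset n) → ∣ p ∣ + ∣ q ∣ ≡ ∣ p ∪ q ∣ + ∣ p ∩ q ∣
  ∣p∣+∣q∣≡∣p∪q∣+∣p∩q∣ []            []            = refl
  ∣p∣+∣q∣≡∣p∪q∣+∣p∩q∣ (inside  ∷ p) (inside  ∷ q) =
    cong suc (trans (+-suc ∣ p ∣ ∣ q ∣)
                    (trans (cong suc (∣p∣+∣q∣≡∣p∪q∣+∣p∩q∣ p q)) (sym (+-suc ∣ p ∪ q ∣ ∣ p ∩ q ∣))))
  ∣p∣+∣q∣≡∣p∪q∣+∣p∩q∣ (inside  ∷ p) (outside ∷ q) = cong suc (∣p∣+∣q∣≡∣p∪q∣+∣p∩q∣ p q)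
  ∣p∣+∣q∣≡∣p∪q∣+∣p∩q∣ (outside ∷ p) (inside  ∷ q) =
    trans (+-suc ∣ p ∣ ∣ q ∣) (cong suc (∣p∣+∣q∣≡∣p∪q∣+∣p∩q∣ p q))
  ∣p∣+∣q∣≡∣p∪q∣+∣p∩q∣ (outside ∷ p) (outside ∷ q) = ∣p∣+∣q∣≡∣p∪q∣+∣p∩q∣ p q

  T-and⁺ : ∀ bs → T (and bs) → All T bs
  T-and⁺ []       _ = []
  T-and⁺ (b ∷ bs) h = let tb , tbs = to T-∧ h in tb ∷ T-and⁺ bs tbs

  T-not-∨ : ∀ a {b} → T (not a ∨ b) ⇔ (T a → T b)
  T-not-∨ true  = mk⇔ const (_$ _)
  T-not-∨ false = mk⇔ (λ _ ()) (const _)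

  all-∧ : ∀ (p q : A → Bool) xs → all (λ x → p x ∧ q x) xs ≡ all p xs ∧ all q xs
  all-∧ p q []       = refl
  all-∧ p q (x ∷ xs) = trans (cong ((p x ∧ q x) ∧_) (all-∧ p q xs))
                             (∧-interchange (p x) (q x) (all p xs) (all q xs))

  restrict-∨ : ∀ a b k → (T k → T (a ∨ b)) → (a ∧ k) ∨ (b ∧ k) ≡ k
  restrict-∨ a b false _     = cong₂ _∨_ (∧-zeroʳ a) (∧-zeroʳ b)
  restrict-∨ a b true  k⇒a∨b =
    trans (cong₂ _∨_ (∧-identityʳ a) (∧-identityʳ b)) (to T-≡ (k⇒a∨b _))

  restrict-∧ : ∀ a b k → (a ∧ k) ∧ (b ∧ k) ≡ (a ∧ b) ∧ k
  restrict-∧ a b k = trans (∧-interchange a k b k) (cong ((a ∧ b) ∧_) (∧-idem k))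

  edge-∨ : ∀ t a₁ b₁ a₂ b₂ e → (T e → T ((a₁ ∧ b₁) ∨ (a₂ ∧ b₂))) →
    (t ∧ a₁ ∧ b₁ ∧ e) ∨ (t ∧ a₂ ∧ b₂ ∧ e) ≡ t ∧ e
  edge-∨ false a₁ b₁ a₂ b₂ e _     = refl
  edge-∨ true  a₁ b₁ a₂ b₂ e cover =
    trans (cong₂ _∨_ (sym (∧-assoc a₁ b₁ e)) (sym (∧-assoc a₂ b₂ e)))
          (restrict-∨ (a₁ ∧ b₁) (a₂ ∧ b₂) e cover)

  edge-∧ : ∀ t a₁ b₁ a₂ b₂ e →
    (t ∧ a₁ ∧ b₁ ∧ e) ∧ (t ∧ a₂ ∧ b₂ ∧ e) ≡ t ∧ (a₁ ∧ a₂) ∧ (b₁ ∧ b₂) ∧ e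
  edge-∧ = solve 6 (λ t a₁ b₁ a₂ b₂ e →
    (t ⊕ a₁ ⊕ b₁ ⊕ e) ⊕ (t ⊕ a₂ ⊕ b₂ ⊕ e) ⊜ t ⊕ (a₁ ⊕ a₂) ⊕ (b₁ ⊕ b₂) ⊕ e) refl
    where open ∧-Solver ∧-idempotentCommutativeMonoid

  mem≡lookup : ∀ (i : Fin n) U → mem i U ≡ lookup U i
  mem≡lookup i U with lookup U i
  ... | inside  = refl
  ... | outside = refl

  T-mem⇔∈ : ∀ {i : Fin n} {U} → T (mem i U) ⇔ i ∈ U
  T-mem⇔∈ {i = i} {U} = mk⇔
    (λ h → lookup⇒[]= i U (trans (sym (mem≡lookup i U)) (to T-≡ h)))
    (λ i∈U → from T-≡ (trans (mem≡lookup i U) ([]=⇒lookup i∈U)))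

  mem-∩ : ∀ (i : Fin n) U W → mem i (U ∩ W) ≡ mem i U ∧ mem i W
  mem-∩ i U W = begin
    mem i (U ∩ W)             ≡⟨ mem≡lookup i (U ∩ W) ⟩
    lookup (U ∩ W) i          ≡⟨ lookup-zipWith _∧_ i U W ⟩
    lookup U i ∧ lookup W i   ≡⟨ sym (cong₂ _∧_ (mem≡lookup i U) (mem≡lookup i W)) ⟩
    mem i U ∧ mem i W         ∎
    where open ≡-Reasoning

  mem-⊤ : ∀ (i : Fin n) → mem i ⊤ ≡ true
  mem-⊤ i = trans (mem≡lookup i ⊤) (lookup-replicate i true)

  ⊆⇒T-subsetᵇ : ∀ {C U : Subset n} → C ⊆ U → T (subsetᵇ C U)
  ⊆⇒T-subsetᵇ {n} {C} {U} C⊆U = all⁻ (λ i → not (mem i C) ∨ mem i U) {allFin n}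
    (All.tabulate λ {i} _ → from (T-not-∨ (mem i C)) (from T-mem⇔∈ ∘ C⊆U ∘ to T-mem⇔∈))

  subsetᵇ-⊤ : ∀ (C : Subset n) → subsetᵇ C ⊤ ≡ true
  subsetᵇ-⊤ C = to T-≡ (⊆⇒T-subsetᵇ {C = C} (λ _ → ∈⊤))

  subsetᵇ-∩ : ∀ (C U W : Subset n) → subsetᵇ C (U ∩ W) ≡ subsetᵇ C U ∧ subsetᵇ C W
  subsetᵇ-∩ {n} C U W = trans
    (cong and (map-cong (λ i → trans (cong (not (mem i C) ∨_) (mem-∩ i U W))
                                     (∨-distribˡ-∧ (not (mem i C)) (mem i U) (mem i W)))
                        (allFin n)))
    (all-∧ _ _ (allFin n))

  IsClique : Graph n → Subset n → Set
  IsClique G C = ∀ {i j} → i ∈ C → j ∈ C → i ≢ j → adj G i j ≡ true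

  isCliqueᵇ-sound : ∀ (G : Graph n) C → T (isCliqueᵇ G C) → IsClique G C
  isCliqueᵇ-sound G C clique {i} {j} i∈C j∈C i≢j =
    to T-≡ (to (T-not-∨ _) pair-checked
      (from T-∧ (from T-mem⇔∈ i∈C , from T-∧ (from T-mem⇔∈ j∈C , from T-not-≡ (dec-false (i ≟ j) i≢j)))))
    where
    pair-checked : T (not (mem i C ∧ mem j C ∧ not (does (i ≟ j))) ∨ adj G i j)
    pair-checked =
      All.lookup (map⁻ (All.lookup (map⁻ (concat⁻ (T-and⁺ _ clique))) (∈-allFin i))) (∈-allFin j)

  module Separation {n} (G : Graph n) (V₁ V₂ : Subset n) (covers : V₁ ∪ V₂ ≡ ⊤)
    (separates : ∀ i j → adj G i j ≡ true → (i ∈ V₁ × j ∈ V₁) ⊎ (i ∈ V₂ × j ∈ V₂)) where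

    ∉V₂⇒∈V₁ : ∀ {i} → i ∉ V₂ → i ∈ V₁
    ∉V₂⇒∈V₁ {i} i∉V₂ =
      [ id , flip contradiction i∉V₂ ]′ (x∈p∪q⁻ V₁ V₂ (subst (i ∈_) (sym covers) ∈⊤))

    -- If C ⊈ V₁, a vertex j ∈ C outside V₂ lies in V₁, and so does every other vertex of C,
    -- being adjacent to j; hence no such j exists.
    clique⊆side : ∀ {C} → IsClique G C → C ⊆ V₁ ⊎ C ⊆ V₂
    clique⊆side {C} clique with C ⊆? V₁
    ... | yes C⊆V₁ = inj₁ C⊆V₁
    ... | no  C⊈V₁ = inj₂ λ {j} j∈C → decidable-stable (j ∈? V₂) λ j∉V₂ → C⊈V₁ λ {k} k∈C →
      C⊆V₁-from j∈C j∉V₂ k∈C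
      where
      C⊆V₁-from : ∀ {j k} → j ∈ C → j ∉ V₂ → k ∈ C → k ∈ V₁
      C⊆V₁-from {j} {k} j∈C j∉V₂ k∈C with j ≟ k
      ... | yes refl = ∉V₂⇒∈V₁ j∉V₂
      ... | no  j≢k  = [ proj₂ , flip contradiction j∉V₂ ∘ proj₁ ]′ (separates j k (clique j∈C k∈C j≢k))

    edge⊆side : ∀ i j → T (adj G i j) → T ((mem i V₁ ∧ mem j V₁) ∨ (mem i V₂ ∧ mem j V₂))
    edge⊆side i j ij∈E = from T-∨ (Sum.map both-mem both-mem (separates i j (to T-≡ ij∈E)))
      where
      both-mem : ∀ {U} → i ∈ U × j ∈ U → T (mem i U ∧ mem j U)
      both-mem (i∈U , j∈U) = from T-∧ (from T-mem⇔∈ i∈U , from T-mem⇔∈ j∈U)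

    cliquesIn-inclusion-exclusion : cliquesIn G V₁ + cliquesIn G V₂ ≡ c G + cliquesIn G (V₁ ∩ V₂)
    cliquesIn-inclusion-exclusion = countᵇ-inclusion-exclusion join meet (allSubsets n)
      where
      cliqueᵇ : Subset n → Subset n → Bool
      cliqueᵇ U C = subsetᵇ C U ∧ isCliqueᵇ G C
      clique⊆sideᵇ : ∀ C → T (isCliqueᵇ G C) → T (subsetᵇ C V₁ ∨ subsetᵇ C V₂)
      clique⊆sideᵇ C =
        from T-∨ ∘ Sum.map ⊆⇒T-subsetᵇ ⊆⇒T-subsetᵇ ∘ clique⊆side ∘ isCliqueᵇ-sound G C
      join : ∀ C → cliqueᵇ V₁ C ∨ cliqueᵇ V₂ C ≡ cliqueᵇ ⊤ C
      join C = trans (restrict-∨ (subsetᵇ C V₁) (subsetᵇ C V₂) (isCliqueᵇ G C) (clique⊆sideᵇ C))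
                     (cong (_∧ isCliqueᵇ G C) (sym (subsetᵇ-⊤ C)))
      meet : ∀ C → cliqueᵇ V₁ C ∧ cliqueᵇ V₂ C ≡ cliqueᵇ (V₁ ∩ V₂) C
      meet C = trans (restrict-∧ (subsetᵇ C V₁) (subsetᵇ C V₂) (isCliqueᵇ G C))
                     (cong (_∧ isCliqueᵇ G C) (sym (subsetᵇ-∩ C V₁ V₂)))

    edgesIn-inclusion-exclusion : edgesIn G V₁ + edgesIn G V₂ ≡ edges G + edgesIn G (V₁ ∩ V₂)
    edgesIn-inclusion-exclusion =
      sum-map-inclusion-exclusion
        (λ i → countᵇ-inclusion-exclusion (join i) (meet i) (allFin n)) (allFin n)
      where
      edgeᵇ : Subset n → Fin n → Fin n → Bool
      edgeᵇ U i j = (toℕ i <ᵇ toℕ j) ∧ mem i U ∧ mem j U ∧ adj G i j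
      join : ∀ i j → edgeᵇ V₁ i j ∨ edgeᵇ V₂ i j ≡ edgeᵇ ⊤ i j
      join i j = trans
        (edge-∨ (toℕ i <ᵇ toℕ j) (mem i V₁) (mem j V₁) (mem i V₂) (mem j V₂) (adj G i j) (edge⊆side i j))
        (cong₂ (λ a b → (toℕ i <ᵇ toℕ j) ∧ a ∧ b ∧ adj G i j) (sym (mem-⊤ i)) (sym (mem-⊤ j)))
      meet : ∀ i j → edgeᵇ V₁ i j ∧ edgeᵇ V₂ i j ≡ edgeᵇ (V₁ ∩ V₂) i j
      meet i j = trans
        (edge-∧ (toℕ i <ᵇ toℕ j) (mem i V₁) (mem j V₁) (mem i V₂) (mem j V₂) (adj G i j))
        (cong₂ (λ a b → (toℕ i <ᵇ toℕ j) ∧ a ∧ b ∧ adj G i j) (sym (mem-∩ i V₁ V₂)) (sym (mem-∩ j V₁ V₂)))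

    verticesIn-inclusion-exclusion : verticesIn V₁ + verticesIn V₂ ≡ n + verticesIn (V₁ ∩ V₂)
    verticesIn-inclusion-exclusion =
      trans (∣p∣+∣q∣≡∣p∪q∣+∣p∩q∣ V₁ V₂) (cong (_+ ∣ V₁ ∩ V₂ ∣) (trans (cong ∣_∣ covers) (∣⊤∣≡n n)))


module OrderedCommRingProperties {a ℓ₁ ℓ₂ : Level} (R : OrderedCommRing a ℓ₁ ℓ₂) where

  open import Data.Nat using (zero; suc)
  import Data.Nat as Nat
  open import Relation.Binary.Structures using (IsTotalOrder)
  open import Relation.Binary.Bundles using (Poset)
  import Relation.Binary.Reasoning.PartialOrder as PartialOrderReasoning
  import Algebra.Solver.Ring.NaturalCoefficients.Default as RingSolver

  open OrderedCommRing R

  poset : Poset a ℓ₁ ℓ₂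
  poset = record { isPartialOrder = IsTotalOrder.isPartialOrder isTotalOrder }

  open PartialOrderReasoning poset

  ι-+ : ∀ m k → ι (m Nat.+ k) ≈ ι m + ι k
  ι-+ zero    k = sym (+-identityˡ (ι k))
  ι-+ (suc m) k = trans (+-congˡ (ι-+ m k)) (sym (+-assoc 1# (ι m) (ι k)))

  ι-inclusion-exclusion : ∀ m₁ m₂ m mₛ → m₁ Nat.+ m₂ ≡.≡ m Nat.+ mₛ → ι m₁ + ι m₂ ≈ ι m + ι mₛ
  ι-inclusion-exclusion m₁ m₂ m mₛ eq =
    trans (sym (ι-+ m₁ m₂)) (trans (reflexive (≡.cong ι eq)) (ι-+ m mₛ))

  +-monoʳ-≤ : ∀ x {y z} → y ≤ z → (x + y) ≤ (x + z)
  +-monoʳ-≤ x {y} {z} y≤z = begin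
    x + y  ≈⟨ +-comm x y ⟩
    y + x  ≤⟨ +-mono-≤ x y≤z ⟩
    z + x  ≈⟨ +-comm z x ⟩
    x + z  ∎

  +-cancelʳ-≤ : ∀ z {x y} → (x + z) ≤ (y + z) → x ≤ y
  +-cancelʳ-≤ z {x} {y} x+z≤y+z = begin
    x              ≈⟨ sym (+-cancel-− x) ⟩
    x + z + - z    ≤⟨ +-mono-≤ (- z) x+z≤y+z ⟩
    y + z + - z    ≈⟨ +-cancel-− y ⟩
    y              ∎
    where
    +-cancel-− : ∀ w → w + z + - z ≈ w
    +-cancel-− w = trans (+-assoc w z (- z)) (trans (+-congˡ (-‿inverseʳ z)) (+-identityʳ w))

  ≤-from-inclusion-exclusion : ∀ {a₁ a₂ a aₛ b₁ b₂ b bₛ} →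
    a₁ + a₂ ≈ a + aₛ → b₁ + b₂ ≈ b + bₛ → a₁ ≤ b₁ → a₂ ≤ b₂ → bₛ ≤ aₛ → a ≤ b
  ≤-from-inclusion-exclusion {a₁} {a₂} {a} {aₛ} {b₁} {b₂} {b} {bₛ} a-ie b-ie a₁≤b₁ a₂≤b₂ bₛ≤aₛ =
    +-cancelʳ-≤ aₛ (begin
      a + aₛ    ≈⟨ sym a-ie ⟩
      a₁ + a₂   ≤⟨ +-mono-≤ a₂ a₁≤b₁ ⟩
      b₁ + a₂   ≤⟨ +-monoʳ-≤ b₁ a₂≤b₂ ⟩
      b₁ + b₂   ≈⟨ b-ie ⟩
      b + bₛ    ≤⟨ +-monoʳ-≤ b bₛ≤aₛ ⟩
      b + aₛ    ∎)

  affine-inclusion-exclusion : ∀ x y z {v₁ v₂ v vₛ e₁ e₂ e eₛ} →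
    v₁ + v₂ ≈ v + vₛ → e₁ + e₂ ≈ e + eₛ →
    (x * v₁ + y * e₁ + z) + (x * v₂ + y * e₂ + z) ≈ (x * v + y * e + z) + (x * vₛ + y * eₛ + z)
  affine-inclusion-exclusion x y z {v₁} {v₂} {v} {vₛ} {e₁} {e₂} {e} {eₛ} v-ie e-ie = begin-equality
    (x * v₁ + y * e₁ + z) + (x * v₂ + y * e₂ + z)  ≈⟨ regroup x y z v₁ e₁ v₂ e₂ ⟩
    x * (v₁ + v₂) + y * (e₁ + e₂) + (z + z)         ≈⟨ +-congʳ (+-cong (*-congˡ v-ie) (*-congˡ e-ie)) ⟩
    x * (v + vₛ) + y * (e + eₛ) + (z + z)           ≈⟨ sym (regroup x y z v e vₛ eₛ) ⟩
    (x * v + y * e + z) + (x * vₛ + y * eₛ + z)     ∎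
    where
    open RingSolver commutativeSemiring using (solve; _:=_; _:+_; _:*_)
    regroup : ∀ x y z A B C D →
      (x * A + y * B + z) + (x * C + y * D + z) ≈ x * (A + C) + y * (B + D) + (z + z)
    regroup = solve 7 (λ x y z A B C D →
      (x :* A :+ y :* B :+ z) :+ (x :* C :+ y :* D :+ z) := x :* (A :+ C) :+ y :* (B :+ D) :+ (z :+ z))
      refl

lemma1 : ∀ {a ℓ₁ ℓ₂ : Level} (R : OrderedCommRing a ℓ₁ ℓ₂) →
    let open OrderedCommRing R in
    ∀ {n : ℕ} (G : Graph n) (V₁ V₂ Vₛ : Subset n) →
    V₁ ∪ V₂ ≡ ⊤ →
    (∀ i j → adj G i j ≡ true → (i ∈ V₁ × j ∈ V₁) ⊎ (i ∈ V₂ × j ∈ V₂)) →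
    V₁ ∩ V₂ ≡ Vₛ →
    ∀ (x y z : Carrier) →
    ι (cliquesIn G V₁) ≤ (x * ι (verticesIn V₁) + y * ι (edgesIn G V₁) + z) →
    ι (cliquesIn G V₂) ≤ (x * ι (verticesIn V₂) + y * ι (edgesIn G V₂) + z) →
    (x * ι (verticesIn Vₛ) + y * ι (edgesIn G Vₛ) + z) ≤ ι (cliquesIn G Vₛ) →
    ι (c G) ≤ (x * ι n + y * ι (edges G) + z)
lemma1 R {n} G V₁ V₂ _ covers separates ≡.refl x y z c₁-bound c₂-bound cₛ-bound =
  ≤-from-inclusion-exclusion
    (ι-inclusion-exclusion (cliquesIn G V₁) (cliquesIn G V₂) (c G) (cliquesIn G (V₁ ∩ V₂))
      cliquesIn-inclusion-exclusion)
    (affine-inclusion-exclusion x y z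
      (ι-inclusion-exclusion (verticesIn V₁) (verticesIn V₂) n (verticesIn (V₁ ∩ V₂))
        verticesIn-inclusion-exclusion)
      (ι-inclusion-exclusion (edgesIn G V₁) (edgesIn G V₂) (edges G) (edgesIn G (V₁ ∩ V₂))
        edgesIn-inclusion-exclusion))
    c₁-bound c₂-bound cₛ-bound
  where
  open OrderedCommRingProperties R
  open Counting.Separation G V₁ V₂ covers separates
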